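{- Let $F$ be either $\mathbb{Z}/m\mathbb{Z}$ (for a positive integer $m$) or $\mathbb{Q}$, let $M$ be an $F$-module, $s$ a positive integer, $A=\{a_1,\dots,a_k\}\subset M$ with $\operatorname{card}(A)=k\ge1$, and let $A_{r,s}$ be as defined below. Let $r=r(\langle A_{r,s}\rangle)$. Then there exists a subset $X=\{x_1,\dots,x_r\}$ of $\langle A_{r,s}\rangle$ of cardinality $r$ such that $x_1\in A_{r,s}$ and $\langle X\rangle=\langle A_{r,s}\rangle$.
   Context: Let $e_1,\dots,e_k$ be the canonical basis of $F^k$, $\phi:F^k\to M$ the $F$-linear map with $\phi(e_i)=a_i$, $R_s\subset F^k$ the set of elements $e_{i_1}+\dots+e_{i_s}-e_{j_1}-\dots-e_{j_s}$ (indices not necessarily distinct), $R_s(A)=R_s\cap\ker\phi$, $\langle X\rangle$ the $F$-submodule generated by $X$, and $A_{r,s}=\{\bar e_1,\dots,\bar e_k\}$ the image of $\{e_1,\dots,e_k\}$ in $F^k/\langle R_s(A)\rangle$. The rank $r(H)$ of an $F$-module $H$ is the least nonnegative integer $r$ such that there is a surjective $F$-linear map $F^r\to H$. -}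

module Defs where

open import Level using (Level; 0ℓ; _⊔_)
open import Data.Nat as ℕ using (ℕ; zero; suc; _≤_; NonZero)
open import Data.Fin as Fin using (Fin; toℕ)
open import Data.Product using (Σ; ∃; _×_; _,_)
open import Data.Integer as ℤ using (ℤ; +_; 0ℤ; 1ℤ)
import Data.Integer.Properties as ℤP
open import Data.Integer.Divisibility.Signed
open import Data.Integer.Tactic.RingSolver using (solve-∀)
open import Relation.Binary.PropositionalEquality using (_≡_; refl; sym; cong; subst)
open import Relation.Nullary using (yes; no)
open import Algebra.Module.Bundles using (Module)
import Data.Rational.Properties as ℚP
open import Algebra.Bundles using (CommutativeRing)
open import Algebra.Structures using (IsCommutativeRing)

module ZMod (m : ℕ) where

  open import Data.Integer using (-_; _-_)

  record _≈_ (x y : ℤ) : Set where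
    constructor mod
    field unmod : (+ m) ∣ (x - y)
  open _≈_

  private
    M = + m

    lift : ∀ {x y} → x ≡ y → x ≈ y
    lift {x} refl = mod (divides 0ℤ (ℤP.+-inverseʳ x))

    id-sym : ∀ x y → y - x ≡ - (x - y)
    id-sym = solve-∀
    id-trans : ∀ x y z → (x - y) ℤ.+ (y - z) ≡ x - z
    id-trans = solve-∀
    id-add : ∀ x y u v → (x - y) ℤ.+ (u - v) ≡ (x ℤ.+ u) - (y ℤ.+ v)
    id-add = solve-∀
    id-mul : ∀ x y u v → x ℤ.* (u - v) ℤ.+ (x - y) ℤ.* v ≡ (x ℤ.* u) - (y ℤ.* v)
    id-mul = solve-∀
    id-neg : ∀ x y → - (x - y) ≡ (- x) - (- y)
    id-neg = solve-∀

    ≈-refl : ∀ {x} → x ≈ x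
    ≈-refl = lift refl
    ≈-sym : ∀ {x y} → x ≈ y → y ≈ x
    ≈-sym {x} {y} (mod p) = mod (subst (M ∣_) (sym (id-sym x y)) (∣m⇒∣-m p))
    ≈-trans : ∀ {x y z} → x ≈ y → y ≈ z → x ≈ z
    ≈-trans {x} {y} {z} (mod p) (mod q) = mod (subst (M ∣_) (id-trans x y z) (∣m∣n⇒∣m+n p q))
    +-cong : ∀ {x y u v} → x ≈ y → u ≈ v → (x ℤ.+ u) ≈ (y ℤ.+ v)
    +-cong {x} {y} {u} {v} (mod p) (mod q) = mod (subst (M ∣_) (id-add x y u v) (∣m∣n⇒∣m+n p q))
    *-cong : ∀ {x y u v} → x ≈ y → u ≈ v → (x ℤ.* u) ≈ (y ℤ.* v)
    *-cong {x} {y} {u} {v} (mod p) (mod q) =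
      mod (subst (M ∣_) (id-mul x y u v) (∣m∣n⇒∣m+n (∣n⇒∣m*n x q) (∣m⇒∣m*n v p)))
    neg-cong : ∀ {x y} → x ≈ y → (- x) ≈ (- y)
    neg-cong {x} {y} (mod p) = mod (subst (M ∣_) (id-neg x y) (∣m⇒∣-m p))

  isCommutativeRing : IsCommutativeRing _≈_ ℤ._+_ ℤ._*_ -_ 0ℤ 1ℤ
  isCommutativeRing = record
    { isRing = record
      { +-isAbelianGroup = record
        { isGroup = record
          { isMonoid = record
            { isSemigroup = record
              { isMagma = record
                { isEquivalence = record { refl = ≈-refl ; sym = ≈-sym ; trans = ≈-trans }
                ; ∙-cong = +-cong }
              ; assoc = λ x y z → lift (ℤP.+-assoc x y z) }
            ; identity = (λ x → lift (ℤP.+-identityˡ x)) , (λ x → lift (ℤP.+-identityʳ x)) }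
          ; inverse = (λ x → lift (ℤP.+-inverseˡ x)) , (λ x → lift (ℤP.+-inverseʳ x))
          ; ⁻¹-cong = neg-cong }
        ; comm = λ x y → lift (ℤP.+-comm x y) }
      ; *-cong = *-cong
      ; *-assoc = λ x y z → lift (ℤP.*-assoc x y z)
      ; *-identity = (λ x → lift (ℤP.*-identityˡ x)) , (λ x → lift (ℤP.*-identityʳ x))
      ; distrib = (λ x y z → lift (ℤP.*-distribˡ-+ x y z)) , (λ x y z → lift (ℤP.*-distribʳ-+ x y z)) }
    ; *-comm = λ x y → lift (ℤP.*-comm x y) }

  commutativeRing : CommutativeRing 0ℓ 0ℓ
  commutativeRing = record { isCommutativeRing = isCommutativeRing }

data Scalars : Set where
  ℤ/_ : (m : ℕ) → .{{NonZero m}} → Scalars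
  ℚˢ  : Scalars

ring : Scalars → CommutativeRing 0ℓ 0ℓ
ring (ℤ/ m) = ZMod.commutativeRing m
ring ℚˢ     = ℚP.+-*-commutativeRing

module Setup {c ℓ mℓ ℓm : Level} (R : CommutativeRing c ℓ) (M : Module R mℓ ℓm)
             (s : ℕ) {k : ℕ} (a : Fin k → Module.Carrierᴹ M) where

  open CommutativeRing R
  open Module M using (Carrierᴹ; _≈ᴹ_; _+ᴹ_; _*ₗ_; 0ᴹ)

  Vecᵏ : Set c
  Vecᵏ = Fin k → Carrier

  _≈ᵥ_ : Vecᵏ → Vecᵏ → Set ℓ
  u ≈ᵥ v = ∀ i → u i ≈ v i

  _+ᵥ_ : Vecᵏ → Vecᵏ → Vecᵏ
  (u +ᵥ v) i = u i + v i

  -ᵥ_ : Vecᵏ → Vecᵏ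
  (-ᵥ u) i = - (u i)

  _-ᵥ_ : Vecᵏ → Vecᵏ → Vecᵏ
  u -ᵥ v = u +ᵥ (-ᵥ v)

  0ᵥ : Vecᵏ
  0ᵥ i = 0#

  _•ᵥ_ : Carrier → Vecᵏ → Vecᵏ
  (x •ᵥ u) i = x * u i

  vsum : ∀ {n} → (Fin n → Vecᵏ) → Vecᵏ
  vsum {zero}  f = 0ᵥ
  vsum {suc n} f = f Fin.zero +ᵥ vsum (λ t → f (Fin.suc t))

  e : Fin k → Vecᵏ
  e i l with i Fin.≟ l
  ... | yes _ = 1#
  ... | no  _ = 0#

  msum : ∀ {n} → (Fin n → Carrierᴹ) → Carrierᴹ
  msum {zero}  f = 0ᴹ
  msum {suc n} f = f Fin.zero +ᴹ msum (λ t → f (Fin.suc t))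

  φ : Vecᵏ → Carrierᴹ
  φ v = msum (λ i → v i *ₗ a i)

  Rₛ : Vecᵏ → Set ℓ
  Rₛ v = Σ (Fin s → Fin k) λ i → Σ (Fin s → Fin k) λ j →
           v ≈ᵥ (vsum (λ t → e (i t)) -ᵥ vsum (λ t → e (j t)))

  RₛA : Vecᵏ → Set (ℓ ⊔ ℓm)
  RₛA v = Rₛ v × (φ v ≈ᴹ 0ᴹ)

  -- the submodule generated by a predicate P, inside R^k equipped with an
  -- equivalence relation _∼_ (used both for R^k and for quotients of R^k)
  data Span {ℓ₁ ℓ₂} (_∼_ : Vecᵏ → Vecᵏ → Set ℓ₁) (P : Vecᵏ → Set ℓ₂)
         : Vecᵏ → Set (c ⊔ ℓ₁ ⊔ ℓ₂) where
    gen  : ∀ {v} → P v → Span _∼_ P v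
    zer  : Span _∼_ P 0ᵥ
    add  : ∀ {u v} → Span _∼_ P u → Span _∼_ P v → Span _∼_ P (u +ᵥ v)
    smul : ∀ x {v} → Span _∼_ P v → Span _∼_ P (x •ᵥ v)
    resp : ∀ {u v} → u ∼ v → Span _∼_ P u → Span _∼_ P v

  -- H = R^k / ⟨R_s(A)⟩, represented by R^k with the quotient equality
  _≈H_ : Vecᵏ → Vecᵏ → Set (c ⊔ ℓ ⊔ ℓm)
  u ≈H v = Span _≈ᵥ_ RₛA (u -ᵥ v)

  SpanH : ∀ {ℓ₂} → (Vecᵏ → Set ℓ₂) → Vecᵏ → Set (c ⊔ ℓ ⊔ ℓm ⊔ ℓ₂)
  SpanH P = Span _≈H_ P

  _∈Aᵣₛ : Vecᵏ → Set (c ⊔ ℓ ⊔ ℓm)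
  w ∈Aᵣₛ = ∃ λ j → w ≈H e j

  ⟨Aᵣₛ⟩ : Vecᵏ → Set (c ⊔ ℓ ⊔ ℓm)
  ⟨Aᵣₛ⟩ = SpanH (λ w → ∃ λ j → w ≡ e j)

  ⟨_⟩ : ∀ {n} → (Fin n → Vecᵏ) → Vecᵏ → Set (c ⊔ ℓ ⊔ ℓm)
  ⟨ X ⟩ = SpanH (λ w → ∃ λ i → w ≡ X i)

  record SurjLin (S : Vecᵏ → Set (c ⊔ ℓ ⊔ ℓm)) (r : ℕ) : Set (c ⊔ ℓ ⊔ ℓm) where
    field
      f      : (Fin r → Carrier) → Vecᵏ
      into   : ∀ x → S (f x)
      f-cong : ∀ x y → (∀ t → x t ≈ y t) → f x ≈H f y
      f-+    : ∀ x y → f (λ t → x t + y t) ≈H (f x +ᵥ f y)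
      f-*    : ∀ λ′ x → f (λ t → λ′ * x t) ≈H (λ′ •ᵥ f x)
      onto   : ∀ v → S v → ∃ λ x → f x ≈H v

  HasRank : (Vecᵏ → Set (c ⊔ ℓ ⊔ ℓm)) → ℕ → Set (c ⊔ ℓ ⊔ ℓm)
  HasRank S r = SurjLin S r × (∀ r′ → SurjLin S r′ → r ≤ r′)

module Submission where

-- Every element of H lies in ⟨A_{r,s}⟩, so surjections F^n → ⟨A_{r,s}⟩ are the
-- same as generating families of H of length n, and r is the least length of a
-- generating family.  In a family of minimal length no two members coincide,
-- since one of them could be dropped.  To put ē_j first we use two facts.
-- (1) The augmentation σ(v) = Σₗ vₗ vanishes on R_s, hence is a linear form on
--     H, and σ(ē_j) = 1.
-- (2) F is a Hermite ring: each pair (c₀, c₁) is D·(a, b) with a·p + b·q = 1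
--     (for ℤ/mℤ by Bézout's identity over ℕ, for ℚ because it is a field).
-- Writing ē_j = Σₜ xₜ Yₜ for a minimal generating family Y, (2) lets us change
-- pairs of generators by invertible 2×2 matrices until ē_j = d·w with w the
-- first member of a new generating family of the same length; by (1),
-- d·σ(w) = 1, so w is a multiple of ē_j, and ē_j may replace w.

open import Defs
open import Level using (Level; _⊔_)
open import Data.Nat as ℕ using (ℕ; zero; suc; _≤_; NonZero)
import Data.Nat.Properties as ℕP
open import Data.Nat.Divisibility using (divides)
open import Data.Nat.GCD using (mkGCD; GCD-*; module GCD; module Bézout)
open GCD using (GCD)
open import Data.Nat.Coprimality using (GCD≡1⇒coprime; coprime-Bézout)
open import Data.Fin as Fin using (Fin; toℕ; punchIn; punchOut)
open import Data.Fin.Properties using (punchInᵢ≢i; punchIn-punchOut)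
open import Data.Integer as ℤ using (+_; 1ℤ)
import Data.Integer.Properties as ℤP
open import Data.Integer.DivMod using (_%ℕ_; _/ℕ_; a≡a%ℕn+[a/ℕn]*n)
open import Data.Integer.Divisibility.Signed using (divides)
open import Data.Integer.Tactic.RingSolver using (solve-∀)
import Data.Rational as ℚ
import Data.Rational.Properties as ℚP
open import Data.Product using (Σ; ∃; _×_; _,_; proj₁; proj₂)
open import Data.Sum using (_⊎_; inj₁; inj₂)
open import Data.Vec.Functional using (Vector; _∷_)
open import Function using (_∘_)
open import Relation.Binary.PropositionalEquality as ≡ using (_≡_; _≢_)
open import Relation.Nullary using (yes; no; contradiction)
open import Algebra.Bundles using (CommutativeRing; Semiring)
open import Algebra.Module.Bundles using (Module)

module HermiteRing {c ℓ} (R : CommutativeRing c ℓ) where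
  open CommutativeRing R
  open import Relation.Binary.Reasoning.Setoid setoid
  open import Algebra.Solver.Ring.NaturalCoefficients.Default commutativeSemiring
  open import Algebra.Properties.Ring (CommutativeRing.ring R) using (-‿distribˡ-*; -‿distribʳ-*; -‿involutive)

  record Factorisation (c₀ c₁ : Carrier) : Set (c ⊔ ℓ) where
    field
      D a b p q  : Carrier
      c₀≈Da      : c₀ ≈ D * a
      c₁≈Db      : c₁ ≈ D * b
      unimodular : a * p + b * q ≈ 1#

  Hermite : Set (c ⊔ ℓ)
  Hermite = ∀ c₀ c₁ → Factorisation c₀ c₁

  factorisation-resp : ∀ {c₀ c₀′ c₁ c₁′} → c₀ ≈ c₀′ → c₁ ≈ c₁′ →
                       Factorisation c₀′ c₁′ → Factorisation c₀ c₁
  factorisation-resp e₀ e₁ f = record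
    { D = D ; a = a ; b = b ; p = p ; q = q
    ; c₀≈Da = trans e₀ c₀≈Da ; c₁≈Db = trans e₁ c₁≈Db ; unimodular = unimodular }
    where open Factorisation f

  field-hermite : (∀ x → x ≈ 0# ⊎ ∃ λ y → x * y ≈ 1#) → Hermite
  field-hermite zero-or-unit c₀ c₁ with zero-or-unit c₀
  ... | inj₁ c₀≈0 = record
    { D = c₁ ; a = 0# ; b = 1# ; p = 0# ; q = 1#
    ; c₀≈Da = trans c₀≈0 (sym (zeroʳ c₁)) ; c₁≈Db = sym (*-identityʳ c₁)
    ; unimodular = trans (+-cong (zeroˡ 0#) (*-identityˡ 1#)) (+-identityˡ 1#) }
  ... | inj₂ (y , c₀y≈1) = record
    { D = c₀ ; a = 1# ; b = y * c₁ ; p = 1# ; q = 0#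
    ; c₀≈Da = sym (*-identityʳ c₀)
    ; c₁≈Db = sym (begin
        c₀ * (y * c₁) ≈⟨ sym (*-assoc c₀ y c₁) ⟩
        c₀ * y * c₁   ≈⟨ *-congʳ c₀y≈1 ⟩
        1# * c₁       ≈⟨ *-identityˡ c₁ ⟩
        c₁            ∎)
    ; unimodular = trans (+-cong (*-identityˡ 1#) (zeroʳ (y * c₁))) (+-identityʳ 1#) }

  -- The unimodular row (a, b) of a factorisation is the first row of the
  -- invertible matrix [[a, b], [-q, p]], whose inverse is [[p, -b], [q, a]].
  module Unimodular {c₀ c₁} (f : Factorisation c₀ c₁) where
    open Factorisation f public

    combine : ∀ x y → c₀ * x + c₁ * y ≈ D * (a * x + b * y)
    combine x y = begin
      c₀ * x + c₁ * y           ≈⟨ +-cong (*-congʳ c₀≈Da) (*-congʳ c₁≈Db) ⟩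
      D * a * x + D * b * y     ≈⟨ solve 5 (λ D a b x y → D :* a :* x :+ D :* b :* y
                                                     := D :* (a :* x :+ b :* y)) refl D a b x y ⟩
      D * (a * x + b * y)       ∎

    recover₀ : ∀ x y → p * (a * x + b * y) + - b * (- q * x + p * y) ≈ x
    recover₀ x y = begin
      p * (a * x + b * y) + - b * (- q * x + p * y)
        ≈⟨ +-congˡ (distribˡ (- b) (- q * x) (p * y)) ⟩
      p * (a * x + b * y) + (- b * (- q * x) + - b * (p * y))
        ≈⟨ +-congˡ (+-cong -b[-qx]≈bqx (sym (-‿distribˡ-* b (p * y)))) ⟩
      p * (a * x + b * y) + (b * (q * x) + - (b * (p * y)))
        ≈⟨ solve 7 (λ a b p q x y n → p :* (a :* x :+ b :* y) :+ (b :* (q :* x) :+ n)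
                                   := (a :* p :+ b :* q) :* x :+ (b :* (p :* y) :+ n))
                   refl a b p q x y (- (b * (p * y))) ⟩
      (a * p + b * q) * x + (b * (p * y) + - (b * (p * y)))
        ≈⟨ +-cong (*-congʳ unimodular) (-‿inverseʳ _) ⟩
      1# * x + 0#
        ≈⟨ trans (+-identityʳ _) (*-identityˡ x) ⟩
      x ∎
      where
      -b[-qx]≈bqx : - b * (- q * x) ≈ b * (q * x)
      -b[-qx]≈bqx = begin
        - b * (- q * x)   ≈⟨ *-congˡ (sym (-‿distribˡ-* q x)) ⟩
        - b * - (q * x)   ≈⟨ sym (-‿distribˡ-* b _) ⟩
        - (b * - (q * x)) ≈⟨ -‿cong (sym (-‿distribʳ-* b _)) ⟩
        - - (b * (q * x)) ≈⟨ -‿involutive _ ⟩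
        b * (q * x)       ∎

    recover₁ : ∀ x y → q * (a * x + b * y) + a * (- q * x + p * y) ≈ y
    recover₁ x y = begin
      q * (a * x + b * y) + a * (- q * x + p * y)
        ≈⟨ +-congˡ (distribˡ a (- q * x) (p * y)) ⟩
      q * (a * x + b * y) + (a * (- q * x) + a * (p * y))
        ≈⟨ +-congˡ (+-congʳ (trans (*-congˡ (sym (-‿distribˡ-* q x))) (sym (-‿distribʳ-* a _)))) ⟩
      q * (a * x + b * y) + (- (a * (q * x)) + a * (p * y))
        ≈⟨ solve 7 (λ a b p q x y n → q :* (a :* x :+ b :* y) :+ (n :+ a :* (p :* y))
                                   := (a :* (q :* x) :+ n) :+ (a :* p :+ b :* q) :* y)
                   refl a b p q x y (- (a * (q * x))) ⟩
      (a * (q * x) + - (a * (q * x))) + (a * p + b * q) * y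
        ≈⟨ +-cong (-‿inverseʳ _) (*-congʳ unimodular) ⟩
      0# + 1# * y
        ≈⟨ trans (+-identityˡ _) (*-identityˡ y) ⟩
      y ∎

module ℤH = HermiteRing ℤP.+-*-commutativeRing

private
  difference-one : ∀ {m n} → suc n ≡ m → + m ℤ.- + n ≡ 1ℤ
  difference-one {n = n} ≡.refl = ≡.trans (≡.cong (ℤ._- + n) (ℤP.pos-+ 1 n)) (cancel (+ n))
    where
    cancel : ∀ z → (1ℤ ℤ.+ z) ℤ.- z ≡ 1ℤ
    cancel = solve-∀

  cofactors₊₋ : ∀ u v w z → u ℤ.* w ℤ.+ v ℤ.* (ℤ.- z) ≡ w ℤ.* u ℤ.- z ℤ.* v
  cofactors₊₋ = solve-∀

  cofactors₋₊ : ∀ u v w z → u ℤ.* (ℤ.- w) ℤ.+ v ℤ.* z ≡ z ℤ.* v ℤ.- w ℤ.* u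
  cofactors₋₊ = solve-∀

  -- the cofactors of a nonzero gcd are coprime, hence satisfy Bézout's identity
  cofactor-bézout : ∀ {n₀ n₁ d a b} → GCD n₀ n₁ (suc d) → n₀ ≡ a ℕ.* suc d → n₁ ≡ b ℕ.* suc d →
                    Bézout.Identity 1 a b
  cofactor-bézout {d = d} g ≡.refl ≡.refl =
    coprime-Bézout (GCD≡1⇒coprime (GCD-* (≡.subst (GCD _ _) (≡.sym (ℕP.*-identityˡ (suc d))) g)))

  scaled : ∀ d a → + (a ℕ.* suc d) ≡ + suc d ℤ.* + a
  scaled d a = ≡.trans (ℤP.pos-* a (suc d)) (ℤP.*-comm (+ a) (+ suc d))

  bézout-factorisation : ∀ {d a b} → Bézout.Identity 1 a b →
                         ℤH.Factorisation (+ (a ℕ.* suc d)) (+ (b ℕ.* suc d))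
  bézout-factorisation {d} {a} {b} (Bézout.+- x y 1+yb≡xa) = record
    { D = + suc d ; a = + a ; b = + b ; p = + x ; q = ℤ.- + y
    ; c₀≈Da = scaled d a ; c₁≈Db = scaled d b
    ; unimodular = ≡.trans (cofactors₊₋ (+ a) (+ b) (+ x) (+ y))
        (≡.trans (≡.cong₂ ℤ._-_ (≡.sym (ℤP.pos-* x a)) (≡.sym (ℤP.pos-* y b)))
                 (difference-one 1+yb≡xa)) }
  bézout-factorisation {d} {a} {b} (Bézout.-+ x y 1+xa≡yb) = record
    { D = + suc d ; a = + a ; b = + b ; p = ℤ.- + x ; q = + y
    ; c₀≈Da = scaled d a ; c₁≈Db = scaled d b
    ; unimodular = ≡.trans (cofactors₋₊ (+ a) (+ b) (+ x) (+ y))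
        (≡.trans (≡.cong₂ ℤ._-_ (≡.sym (ℤP.pos-* y b)) (≡.sym (ℤP.pos-* x a)))
                 (difference-one 1+xa≡yb)) }

-- Pairs of naturals factor in ℤ: divide out the gcd (if nonzero) and use
-- Bézout's identity for the coprime cofactors.
natural-factorisation : ∀ n₀ n₁ → ℤH.Factorisation (+ n₀) (+ n₁)
natural-factorisation n₀ n₁ with mkGCD n₀ n₁
... | zero , GCD.is (divides a n₀≡a*0 , divides b n₁≡b*0) _ = record
  { D = + 0 ; a = 1ℤ ; b = + 0 ; p = 1ℤ ; q = + 0
  ; c₀≈Da = ≡.cong +_ (≡.trans n₀≡a*0 (ℕP.*-zeroʳ a))
  ; c₁≈Db = ≡.cong +_ (≡.trans n₁≡b*0 (ℕP.*-zeroʳ b))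
  ; unimodular = ≡.refl }
... | suc d , g@(GCD.is (divides a n₀≡ad , divides b n₁≡bd) _) =
  ≡.subst₂ ℤH.Factorisation (≡.cong +_ (≡.sym n₀≡ad)) (≡.cong +_ (≡.sym n₁≡bd))
    (bézout-factorisation {d} {a} {b} (cofactor-bézout g n₀≡ad n₁≡bd))

-- ℤ/mℤ is Hermite: reduce both entries mod m and push the factorisation of
-- the residues along ℤ → ℤ/mℤ (same carrier and operations).
zmod-hermite : ∀ m .{{_ : NonZero m}} → HermiteRing.Hermite (ring (ℤ/ m))
zmod-hermite m c₀ c₁ =
  factorisation-resp (residue c₀) (residue c₁) (reduce (natural-factorisation (c₀ %ℕ m) (c₁ %ℕ m)))
  where
  open HermiteRing (ring (ℤ/ m))
  open CommutativeRing (ring (ℤ/ m)) using (_≈_; reflexive)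

  residue : ∀ c → c ≈ + (c %ℕ m)
  residue c = ZMod.mod (divides (c /ℕ m)
    (≡.trans (≡.cong (ℤ._- + (c %ℕ m)) (a≡a%ℕn+[a/ℕn]*n c m)) (cancel (+ (c %ℕ m)) (c /ℕ m) (+ m))))
    where
    cancel : ∀ r q n → (r ℤ.+ q ℤ.* n) ℤ.- r ≡ q ℤ.* n
    cancel = solve-∀

  reduce : ∀ {x y} → ℤH.Factorisation x y → Factorisation x y
  reduce f = record
    { D = D ; a = a ; b = b ; p = p ; q = q
    ; c₀≈Da = reflexive c₀≈Da ; c₁≈Db = reflexive c₁≈Db ; unimodular = reflexive unimodular }
    where open ℤH.Factorisation f

ℚ-hermite : HermiteRing.Hermite (ring ℚˢ)
ℚ-hermite = HermiteRing.field-hermite (ring ℚˢ) zero-or-unit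
  where
  zero-or-unit : ∀ x → x ≡ ℚ.0ℚ ⊎ ∃ λ y → x ℚ.* y ≡ ℚ.1ℚ
  zero-or-unit x with x ℚP.≟ ℚ.0ℚ
  ... | yes x≡0 = inj₁ x≡0
  ... | no x≢0 = inj₂ (ℚ.1/_ x {{ℚ.≢-nonZero x≢0}} , ℚP.*-inverseʳ x {{ℚ.≢-nonZero x≢0}})

hermite : (F : Scalars) → HermiteRing.Hermite (ring F)
hermite (ℤ/ m) = zmod-hermite m
hermite ℚˢ     = ℚ-hermite

module KroneckerSums {c ℓ} (R : Semiring c ℓ) where
  open Semiring R
  open import Algebra.Properties.Semiring.Sum R public

  δ : ∀ {n} → Fin n → Fin n → Carrier
  δ i j with i Fin.≟ j
  ... | yes _ = 1#
  ... | no  _ = 0#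

  δ-diag : ∀ {n} (i : Fin n) → δ i i ≈ 1#
  δ-diag i with i Fin.≟ i
  ... | yes _   = refl
  ... | no  i≢i = contradiction ≡.refl i≢i

  δ-off : ∀ {n} {i j : Fin n} → i ≢ j → δ i j ≈ 0#
  δ-off {i = i} {j} i≢j with i Fin.≟ j
  ... | yes i≡j = contradiction i≡j i≢j
  ... | no  _   = refl

  sum-single : ∀ {n} (f : Vector Carrier n) i → (∀ j → j ≢ i → f j ≈ 0#) → sum f ≈ f i
  sum-single {suc n} f i vanish = begin
    sum f                                 ≈⟨ sum-remove {i = i} f ⟩
    f i + sum {n} (λ j → f (punchIn i j)) ≈⟨ +-congˡ (sum-cong-≋ {n} (λ j → vanish _ (punchInᵢ≢i i j))) ⟩
    f i + sum {n} (λ _ → 0#)              ≈⟨ +-congˡ (sum-replicate-zero n) ⟩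
    f i + 0#                              ≈⟨ +-identityʳ (f i) ⟩
    f i                                   ∎
    where open import Relation.Binary.Reasoning.Setoid setoid

  sum-δˡ : ∀ {n} (i : Fin n) (y : Vector Carrier n) → sum (λ j → δ i j * y j) ≈ y i
  sum-δˡ i y = trans (sum-single _ i (λ j j≢i → trans (*-congʳ (δ-off (j≢i ∘ ≡.sym))) (zeroˡ (y j))))
                     (trans (*-congʳ (δ-diag i)) (*-identityˡ (y i)))

  sum-δʳ : ∀ {n} (x : Vector Carrier n) (i : Fin n) → sum (λ j → x j * δ j i) ≈ x i
  sum-δʳ x i = trans (sum-single _ i (λ j j≢i → trans (*-congˡ (δ-off j≢i)) (zeroʳ (x j))))
                     (trans (*-congˡ (δ-diag i)) (*-identityʳ (x i)))

module Development {c ℓ mℓ ℓm : Level} (R : CommutativeRing c ℓ) (M : Module R mℓ ℓm)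
                   (s : ℕ) {k : ℕ} (A : Fin k → Module.Carrierᴹ M) where

  open CommutativeRing R
  open Setup R M s A
  open HermiteRing R
  open KroneckerSums semiring
  open import Relation.Binary.Reasoning.Setoid setoid
  open import Algebra.Solver.Ring.NaturalCoefficients.Default commutativeSemiring
    using (solve; _:+_; _:*_; _:=_)
  open import Algebra.Properties.Ring (CommutativeRing.ring R)
    using (-1*x≈-x; -‿+-comm; ⁻¹-anti-homo‿-; x[y-z]≈xy-xz; x≈y⇒x∙y⁻¹≈ε; x∙y⁻¹≈ε⇒x≈y)

  ≈ᵥ⇒≈H : ∀ {u v} → u ≈ᵥ v → u ≈H v
  ≈ᵥ⇒≈H u≈v = resp (λ i → sym (x≈y⇒x∙y⁻¹≈ε (u≈v i))) zer

  ≈H-refl : ∀ {u} → u ≈H u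
  ≈H-refl = ≈ᵥ⇒≈H (λ _ → refl)

  ≈H-sym : ∀ {u v} → u ≈H v → v ≈H u
  ≈H-sym u≈v = resp (λ i → trans (-1*x≈-x _) (⁻¹-anti-homo‿- _ _)) (smul (- 1#) u≈v)

  ≈H-trans : ∀ {u v w} → u ≈H v → v ≈H w → u ≈H w
  ≈H-trans u≈v v≈w = resp (λ i → telescope _ _ _) (add u≈v v≈w)
    where
    telescope : ∀ x y z → (x + - y) + (y + - z) ≈ x + - z
    telescope x y z = begin
      (x + - y) + (y + - z) ≈⟨ solve 4 (λ x y y′ z′ → (x :+ y′) :+ (y :+ z′) := x :+ ((y′ :+ y) :+ z′))
                                       refl x y (- y) (- z) ⟩
      x + ((- y + y) + - z) ≈⟨ +-congˡ (trans (+-congʳ (-‿inverseˡ y)) (+-identityˡ (- z))) ⟩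
      x + - z               ∎

  ≈H-+ : ∀ {u u′ v v′} → u ≈H u′ → v ≈H v′ → (u +ᵥ v) ≈H (u′ +ᵥ v′)
  ≈H-+ u≈u′ v≈v′ = resp (λ i → interchange _ _ _ _) (add u≈u′ v≈v′)
    where
    interchange : ∀ x x′ y y′ → (x + - x′) + (y + - y′) ≈ (x + y) + - (x′ + y′)
    interchange x x′ y y′ = begin
      (x + - x′) + (y + - y′) ≈⟨ solve 4 (λ x x″ y y″ → (x :+ x″) :+ (y :+ y″) := (x :+ y) :+ (x″ :+ y″))
                                         refl x (- x′) y (- y′) ⟩
      (x + y) + (- x′ + - y′) ≈⟨ +-congˡ (-‿+-comm x′ y′) ⟩
      (x + y) + - (x′ + y′)   ∎

  ≈H-• : ∀ x {u u′} → u ≈H u′ → (x •ᵥ u) ≈H (x •ᵥ u′)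
  ≈H-• x u≈u′ = resp (λ i → x[y-z]≈xy-xz x _ _) (smul x u≈u′)

  generator : ∀ {n} (Z : Fin n → Vecᵏ) t → ⟨ Z ⟩ (Z t)
  generator Z t = gen (t , ≡.refl)

  span-⊆ : ∀ {m n} {Z : Fin m → Vecᵏ} {Z′ : Fin n → Vecᵏ} →
           (∀ t → ⟨ Z′ ⟩ (Z t)) → ∀ {v} → ⟨ Z ⟩ v → ⟨ Z′ ⟩ v
  span-⊆ Z⊆Z′ (gen (t , ≡.refl)) = Z⊆Z′ t
  span-⊆ Z⊆Z′ zer                = zer
  span-⊆ Z⊆Z′ (add p q)          = add (span-⊆ Z⊆Z′ p) (span-⊆ Z⊆Z′ q)
  span-⊆ Z⊆Z′ (smul x p)         = smul x (span-⊆ Z⊆Z′ p)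
  span-⊆ Z⊆Z′ (resp u≈v p)       = resp u≈v (span-⊆ Z⊆Z′ p)

  lc : ∀ {n} → (Fin n → Carrier) → (Fin n → Vecᵏ) → Vecᵏ
  lc x Z l = sum (λ t → x t * Z t l)

  lc-∈ : ∀ {ℓ′} {P : Vecᵏ → Set ℓ′} {n} (x : Fin n → Carrier) (Z : Fin n → Vecᵏ) →
         (∀ t → SpanH P (Z t)) → SpanH P (lc x Z)
  lc-∈ {n = zero}  x Z Z∈ = zer
  lc-∈ {n = suc n} x Z Z∈ =
    add (smul (x Fin.zero) (Z∈ Fin.zero)) (lc-∈ (x ∘ Fin.suc) (Z ∘ Fin.suc) (Z∈ ∘ Fin.suc))

  lc-cong : ∀ {n} {x y : Fin n → Carrier} (Z : Fin n → Vecᵏ) → (∀ t → x t ≈ y t) → lc x Z ≈ᵥ lc y Z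
  lc-cong {n} Z x≈y l = sum-cong-≋ {n} (λ t → *-congʳ (x≈y t))

  lc-+ : ∀ {n} (x y : Fin n → Carrier) (Z : Fin n → Vecᵏ) → lc (λ t → x t + y t) Z ≈ᵥ (lc x Z +ᵥ lc y Z)
  lc-+ {n} x y Z l = trans (sum-cong-≋ {n} (λ t → distribʳ (Z t l) (x t) (y t)))
                           (∑-distrib-+ (λ t → x t * Z t l) (λ t → y t * Z t l))

  lc-• : ∀ {n} z (x : Fin n → Carrier) (Z : Fin n → Vecᵏ) → lc (λ t → z * x t) Z ≈ᵥ (z •ᵥ lc x Z)
  lc-• {n} z x Z l = trans (sum-cong-≋ {n} (λ t → *-assoc z (x t) (Z t l)))
                           (sym (*-distribˡ-sum z (λ t → x t * Z t l)))

  lc-0 : ∀ {n} (Z : Fin n → Vecᵏ) → lc (λ _ → 0#) Z ≈ᵥ 0ᵥ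
  lc-0 {n} Z l = trans (sum-cong-≋ {n} (λ t → zeroˡ (Z t l))) (sum-replicate-zero n)

  span⇒lc : ∀ {n} (Z : Fin n → Vecᵏ) {v} → ⟨ Z ⟩ v → ∃ λ x → lc x Z ≈H v
  span⇒lc Z (gen (i , ≡.refl)) = δ i , ≈ᵥ⇒≈H (λ l → sum-δˡ i (λ t → Z t l))
  span⇒lc Z zer                = (λ _ → 0#) , ≈ᵥ⇒≈H (lc-0 Z)
  span⇒lc Z (add p q) with span⇒lc Z p | span⇒lc Z q
  ... | x , Σx≈u | y , Σy≈v = (λ t → x t + y t) , ≈H-trans (≈ᵥ⇒≈H (lc-+ x y Z)) (≈H-+ Σx≈u Σy≈v)
  span⇒lc Z (smul z p) with span⇒lc Z p
  ... | x , Σx≈v = (λ t → z * x t) , ≈H-trans (≈ᵥ⇒≈H (lc-• z x Z)) (≈H-• z Σx≈v)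
  span⇒lc Z (resp u≈v p) with span⇒lc Z p
  ... | x , Σx≈u = x , ≈H-trans Σx≈u u≈v

  -- Every element of H lies in ⟨A_{r,s}⟩, since v = Σₗ vₗ eₗ.

  e≡δ : ∀ i j → e i j ≡ δ i j
  e≡δ i j with i Fin.≟ j
  ... | yes _ = ≡.refl
  ... | no  _ = ≡.refl

  ⟨A⟩-everything : ∀ v → ⟨Aᵣₛ⟩ v
  ⟨A⟩-everything v = resp (≈ᵥ⇒≈H expand) (lc-∈ v e (λ t → gen (t , ≡.refl)))
    where
    expand : lc v e ≈ᵥ v
    expand l = trans (sum-cong-≋ {k} (λ t → *-congˡ (reflexive (e≡δ t l)))) (sum-δʳ v l)

  -- Hence the surjections R^n → ⟨A_{r,s}⟩ correspond to generating families of length n.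

  Generates : ∀ {n} → (Fin n → Vecᵏ) → Set (c ⊔ ℓ ⊔ ℓm)
  Generates Z = ∀ v → ⟨ Z ⟩ v

  generators⇒surjection : ∀ {n} {Z : Fin n → Vecᵏ} → Generates Z → SurjLin ⟨Aᵣₛ⟩ n
  generators⇒surjection {Z = Z} generates = record
    { f      = λ x → lc x Z
    ; into   = λ x → ⟨A⟩-everything (lc x Z)
    ; f-cong = λ x y x≈y → ≈ᵥ⇒≈H (lc-cong Z x≈y)
    ; f-+    = λ x y → ≈ᵥ⇒≈H (lc-+ x y Z)
    ; f-*    = λ z x → ≈ᵥ⇒≈H (lc-• z x Z)
    ; onto   = λ v _ → span⇒lc Z (generates v) }

  -- the images of the standard basis vectors δₜ generate
  surjection⇒generators : ∀ {r} → SurjLin ⟨Aᵣₛ⟩ r → Σ (Fin r → Vecᵏ) Generates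
  surjection⇒generators {r} surj = X , generates
    where
    open SurjLin surj
    X : Fin r → Vecᵏ
    X t = f (δ t)

    image-sum : ∀ m (g : Fin m → Fin r → Carrier) → (∀ t → ⟨ X ⟩ (f (g t))) →
                ⟨ X ⟩ (f (λ l → sum (λ t → g t l)))
    image-sum zero    g g∈ = resp (≈H-sym f0≈0) zer
      where
      f0≈0 : f (λ _ → 0#) ≈H 0ᵥ
      f0≈0 = ≈H-trans (f-cong _ (λ _ → 0# * 0#) (λ _ → sym (zeroˡ 0#)))
               (≈H-trans (f-* 0# (λ _ → 0#)) (≈ᵥ⇒≈H (λ l → zeroˡ _)))
    image-sum (suc m) g g∈ = resp (≈H-sym (f-+ (g Fin.zero) (λ l → sum (λ t → g (Fin.suc t) l))))
                               (add (g∈ Fin.zero) (image-sum m (g ∘ Fin.suc) (g∈ ∘ Fin.suc)))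

    generates : Generates X
    generates v with onto v (⟨A⟩-everything v)
    ... | x , fx≈v = resp (≈H-trans (f-cong _ x (λ l → sum-δʳ x l)) fx≈v)
                       (image-sum r (λ t l → x t * δ t l)
                          (λ t → resp (≈H-sym (f-* (x t) (δ t))) (smul (x t) (generator X t))))

  drop-duplicate : ∀ {n} {Y : Fin (suc n) → Vecᵏ} {i j} → Generates Y →
                   Y i ≈H Y j → i ≢ j → Generates (Y ∘ punchIn i)
  drop-duplicate {Y = Y} {i} {j} generates Yi≈Yj i≢j v = span-⊆ member (generates v)
    where
    Z : Fin _ → Vecᵏ
    Z = Y ∘ punchIn i
    survivor : ∀ {t} → i ≢ t → ⟨ Z ⟩ (Y t)
    survivor i≢t = ≡.subst (λ u → ⟨ Z ⟩ (Y u)) (punchIn-punchOut i≢t) (generator Z (punchOut i≢t))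
    member : ∀ t → ⟨ Z ⟩ (Y t)
    member t with i Fin.≟ t
    ... | yes ≡.refl = resp (≈H-sym Yi≈Yj) (survivor i≢j)
    ... | no  i≢t    = survivor i≢t

  minimal⇒distinct : ∀ {n} {Y : Fin n → Vecᵏ} → Generates Y →
                     (∀ r′ → SurjLin ⟨Aᵣₛ⟩ r′ → n ≤ r′) → ∀ i j → Y i ≈H Y j → i ≡ j
  minimal⇒distinct {suc n} generates minimal i j Yi≈Yj with i Fin.≟ j
  ... | yes i≡j = i≡j
  ... | no  i≢j = contradiction (minimal n (generators⇒surjection (drop-duplicate generates Yi≈Yj i≢j)))
                                (ℕP.n≮n n)

  -- The augmentation σ(v) = Σₗ vₗ is linear, vanishes on R_s (both halves of
  -- an element of R_s have coordinate sum s), and so is well defined on H.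

  σ : Vecᵏ → Carrier
  σ = sum

  σ-+ : ∀ u v → σ (u +ᵥ v) ≈ σ u + σ v
  σ-+ = ∑-distrib-+

  σ-• : ∀ x v → σ (x •ᵥ v) ≈ x * σ v
  σ-• x v = sym (*-distribˡ-sum x v)

  σ-- : ∀ u v → σ (u -ᵥ v) ≈ σ u + - σ v
  σ-- u v = begin
    σ (u -ᵥ v)               ≈⟨ σ-+ u (-ᵥ v) ⟩
    σ u + σ (-ᵥ v)           ≈⟨ +-congˡ (sum-cong-≋ {k} (λ i → sym (-1*x≈-x (v i)))) ⟩
    σ u + σ ((- 1#) •ᵥ v)    ≈⟨ +-congˡ (trans (σ-• (- 1#) v) (-1*x≈-x (σ v))) ⟩
    σ u + - σ v              ∎

  σ-e : ∀ i → σ (e i) ≈ 1#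
  σ-e i = trans (sum-cong-≋ {k} (λ j → reflexive (e≡δ i j)))
                (trans (sum-single (δ i) i (λ j j≢i → δ-off (j≢i ∘ ≡.sym))) (δ-diag i))

  σ-basis-sum : ∀ {n} (ι : Fin n → Fin k) → σ (vsum (λ t → e (ι t))) ≈ sum {n} (λ _ → 1#)
  σ-basis-sum {zero}  ι = sum-replicate-zero k
  σ-basis-sum {suc n} ι =
    trans (σ-+ (e (ι Fin.zero)) _) (+-cong (σ-e (ι Fin.zero)) (σ-basis-sum (ι ∘ Fin.suc)))

  σ-Rₛ : ∀ {v} → Rₛ v → σ v ≈ 0#
  σ-Rₛ {v} (i , j , v≈) = begin
    σ v                                                 ≈⟨ sum-cong-≋ {k} v≈ ⟩
    σ (vsum (λ t → e (i t)) -ᵥ vsum (λ t → e (j t)))    ≈⟨ σ-- _ _ ⟩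
    σ (vsum (λ t → e (i t))) + - σ (vsum (λ t → e (j t)))
      ≈⟨ +-cong (σ-basis-sum i) (-‿cong (σ-basis-sum j)) ⟩
    sum {s} (λ _ → 1#) + - sum {s} (λ _ → 1#)           ≈⟨ -‿inverseʳ _ ⟩
    0#                                                  ∎

  σ-⟨RₛA⟩ : ∀ {v} → Span _≈ᵥ_ RₛA v → σ v ≈ 0#
  σ-⟨RₛA⟩ (gen (v∈Rₛ , _)) = σ-Rₛ v∈Rₛ
  σ-⟨RₛA⟩ zer              = sum-replicate-zero k
  σ-⟨RₛA⟩ (add {u} {v} p q) = trans (σ-+ u v) (trans (+-cong (σ-⟨RₛA⟩ p) (σ-⟨RₛA⟩ q)) (+-identityˡ 0#))
  σ-⟨RₛA⟩ (smul x {v} p)   = trans (σ-• x v) (trans (*-congˡ (σ-⟨RₛA⟩ p)) (zeroʳ x))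
  σ-⟨RₛA⟩ (resp u≈v p)     = trans (sym (sum-cong-≋ {k} u≈v)) (σ-⟨RₛA⟩ p)

  σ-resp : ∀ {u v} → u ≈H v → σ u ≈ σ v
  σ-resp {u} {v} u≈v = x∙y⁻¹≈ε⇒x≈y (σ u) (σ v) (trans (sym (σ-- u v)) (σ-⟨RₛA⟩ u≈v))

  record Concentration {n} (d : Carrier) (w : Vecᵏ) (x : Fin n → Carrier) (T : Fin n → Vecᵏ)
                       : Set (c ⊔ ℓ ⊔ ℓm) where
    field
      scale        : Carrier
      pivot        : Vecᵏ
      others       : Fin n → Vecᵏ
      concentrated : ((d •ᵥ w) +ᵥ lc x T) ≈H (scale •ᵥ pivot)
      spans-w      : ⟨ pivot ∷ others ⟩ w
      spans-T      : ∀ t → ⟨ pivot ∷ others ⟩ (T t)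

  -- Induction on n: the factorisation (d, x₀) = D·(a, b), (a, b) unimodular, replaces
  -- (w, T₀) by (a·w + b·T₀, -q·w + p·T₀), an invertible change of the pair, and
  -- turns d·w + x₀·T₀ into D·(a·w + b·T₀).
  concentrate : Hermite → ∀ {n} d w (x : Fin n → Carrier) (T : Fin n → Vecᵏ) → Concentration d w x T
  concentrate hermite {zero} d w x T = record
    { scale = d ; pivot = w ; others = λ ()
    ; concentrated = ≈ᵥ⇒≈H (λ l → +-identityʳ (d * w l))
    ; spans-w = generator (w ∷ λ ()) Fin.zero ; spans-T = λ () }
  concentrate hermite {suc n} d w x T = record
    { scale = C.scale ; pivot = C.pivot ; others = Y ∷ C.others
    ; concentrated = ≈H-trans (≈ᵥ⇒≈H merge) C.concentrated
    ; spans-w = resp (≈ᵥ⇒≈H (λ l → recover₀ (w l) (T₀ l))) (add (smul p w′∈) (smul (- b) Y∈))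
    ; spans-T = λ { Fin.zero → resp (≈ᵥ⇒≈H (λ l → recover₁ (w l) (T₀ l))) (add (smul q w′∈) (smul a Y∈))
                  ; (Fin.suc t) → embed (C.spans-T t) } }
    where
    open Unimodular (hermite d (x Fin.zero))
    T₀ w′ Y : Vecᵏ
    T₀ = T Fin.zero
    w′ = (a •ᵥ w) +ᵥ (b •ᵥ T₀)
    Y  = ((- q) •ᵥ w) +ᵥ (p •ᵥ T₀)
    module C = Concentration (concentrate hermite D w′ (x ∘ Fin.suc) (T ∘ Fin.suc))
    G : Fin (suc (suc n)) → Vecᵏ
    G = C.pivot ∷ (Y ∷ C.others)

    merge : ((d •ᵥ w) +ᵥ lc x T) ≈ᵥ ((D •ᵥ w′) +ᵥ lc (x ∘ Fin.suc) (T ∘ Fin.suc))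
    merge l = trans (sym (+-assoc _ _ _)) (+-congʳ (combine (w l) (T₀ l)))

    embed : ∀ {v} → ⟨ C.pivot ∷ C.others ⟩ v → ⟨ G ⟩ v
    embed = span-⊆ λ { Fin.zero → generator G Fin.zero ; (Fin.suc t) → generator G (Fin.suc (Fin.suc t)) }

    w′∈ : ⟨ G ⟩ w′
    w′∈ = embed C.spans-w
    Y∈ : ⟨ G ⟩ Y
    Y∈ = generator G (Fin.suc Fin.zero)

  -- Writing u = Σₜ xₜ Yₜ and
  -- concentrating gives u = d·w; then d·σ(w) = σ(u) = 1, so w = σ(w)·u.
  exchange : Hermite → ∀ {n} {Y : Fin (suc n) → Vecᵏ} → Generates Y →
             ∀ {u} → σ u ≈ 1# → Σ (Fin n → Vecᵏ) λ T → Generates (u ∷ T)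
  exchange hermite {n} {Y} generates {u} σu≈1 = C.others , λ v → span-⊆ Y∈ (generates v)
    where
    combination : ∃ λ x → lc x Y ≈H u
    combination = span⇒lc Y (generates u)
    x : Fin (suc n) → Carrier
    x = proj₁ combination
    module C = Concentration (concentrate hermite (x Fin.zero) (Y Fin.zero) (x ∘ Fin.suc) (Y ∘ Fin.suc))
    X : Fin (suc n) → Vecᵏ
    X = u ∷ C.others

    u≈dw : u ≈H (C.scale •ᵥ C.pivot)
    u≈dw = ≈H-trans (≈H-sym (proj₂ combination)) C.concentrated

    dσw≈1 : C.scale * σ C.pivot ≈ 1#
    dσw≈1 = trans (sym (σ-• C.scale C.pivot)) (trans (sym (σ-resp u≈dw)) σu≈1)

    pivot∈ : ⟨ X ⟩ C.pivot
    pivot∈ = resp (≈H-trans (≈H-• (σ C.pivot) u≈dw) (≈ᵥ⇒≈H rescale))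
                  (smul (σ C.pivot) (generator X Fin.zero))
      where
      rescale : ∀ l → σ C.pivot * (C.scale * C.pivot l) ≈ C.pivot l
      rescale l = begin
        σ C.pivot * (C.scale * C.pivot l) ≈⟨ sym (*-assoc _ _ _) ⟩
        σ C.pivot * C.scale * C.pivot l   ≈⟨ *-congʳ (trans (*-comm _ _) dσw≈1) ⟩
        1# * C.pivot l                    ≈⟨ *-identityˡ _ ⟩
        C.pivot l                         ∎

    concentrated⊆X : ∀ {v} → ⟨ C.pivot ∷ C.others ⟩ v → ⟨ X ⟩ v
    concentrated⊆X = span-⊆ λ { Fin.zero → pivot∈ ; (Fin.suc t) → generator X (Fin.suc t) }

    Y∈ : ∀ t → ⟨ X ⟩ (Y t)
    Y∈ Fin.zero    = concentrated⊆X C.spans-w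
    Y∈ (Fin.suc t) = concentrated⊆X (C.spans-T t)

  family-through : Hermite → ∀ {r} → SurjLin ⟨Aᵣₛ⟩ r → (j : Fin k) →
                   Σ (Fin r → Vecᵏ) λ X → Generates X × (∀ i → toℕ i ≡ 0 → X i ∈Aᵣₛ)
  family-through hermite {zero} surj j = proj₁ generators , proj₂ generators , λ ()
    where
    generators : Σ (Fin 0 → Vecᵏ) Generates
    generators = surjection⇒generators surj
  family-through hermite {suc r} surj j = (e j ∷ proj₁ exchanged) , proj₂ exchanged , first∈A
    where
    exchanged : Σ (Fin r → Vecᵏ) λ T → Generates (e j ∷ T)
    exchanged = exchange hermite (proj₂ (surjection⇒generators surj)) (σ-e j)
    first∈A : ∀ i → toℕ i ≡ 0 → (e j ∷ proj₁ exchanged) i ∈Aᵣₛ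
    first∈A Fin.zero    _ = j , ≈H-refl
    first∈A (Fin.suc i) ()

lemma13 : {mℓ ℓm : Level} (F : Scalars) (M : Module (ring F) mℓ ℓm)
          (s : ℕ) → 1 ≤ s →
          (k : ℕ) → 1 ≤ k →
          (a : Fin k → Module.Carrierᴹ M) →
          (∀ i j → Module._≈ᴹ_ M (a i) (a j) → i ≡ j) →
          let open Setup (ring F) M s a in
          (r : ℕ) → HasRank ⟨Aᵣₛ⟩ r →
          Σ (Fin r → Vecᵏ) λ X →
            (∀ i → ⟨Aᵣₛ⟩ (X i))
            × (∀ i j → X i ≈H X j → i ≡ j)
            × (∀ i → toℕ i ≡ 0 → X i ∈Aᵣₛ)
            × (∀ v → (⟨ X ⟩ v → ⟨Aᵣₛ⟩ v) × (⟨Aᵣₛ⟩ v → ⟨ X ⟩ v))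
lemma13 F M s _ k k≥1 a _ r (surjection , minimal) =
  X , (λ i → ⟨A⟩-everything (X i)) , minimal⇒distinct generates minimal , first∈A
    , λ v → (λ _ → ⟨A⟩-everything v) , (λ _ → generates v)
  where
  open Setup (ring F) M s a
  open Development (ring F) M s a
  family : Σ (Fin r → Vecᵏ) λ X → Generates X × (∀ i → toℕ i ≡ 0 → X i ∈Aᵣₛ)
  family = family-through (hermite F) surjection (Fin.fromℕ< k≥1)
  X : Fin r → Vecᵏ
  X = proj₁ family
  generates : Generates X
  generates = proj₁ (proj₂ family)
  first∈A : ∀ i → toℕ i ≡ 0 → X i ∈Aᵣₛ
  first∈A = proj₂ (proj₂ family)
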